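{- Let $G=(V,E)$ be a graph, let $u\in V$, $S\subseteq N(u)$, and set $V'=V\setminus\{u\}$. Suppose $E$ is given a total ordering in which the edges incident to $u$ are larger than all other edges. Let $F$ be a broken-circuit-free edge set of the induced subgraph $G[V']$ (with respect to the induced ordering) such that every non-trivial component of $(V',F)$ contains exactly one vertex of $S$. Then $T=F\cup\{us: s\in S\}$ is a tree, and $T$ contains a broken circuit of $G$ if and only if there is some $s\in S$ such that the non-trivial component of $(V',F)$ containing $s$ also contains some $t\in N(u)$ with $us<ut$ in the ordering of $E$.
   Context: Given a graph $H$ with a total ordering of its edges, a broken circuit is the edge set of a cycle of $H$ with its largest edge removed. An edge set is broken-circuit-free (BCF) if it contains no broken circuit. A non-trivial component of $(V',F)$ is a connected component that is not an isolated vertex. $N(u)$ denotes the set of neighbours of $u$. -}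

module Defs where

open import Data.Nat using (ℕ; zero; suc; _≤_; _<_)
open import Data.Fin using (Fin; zero; suc; inject₁; fromℕ)
open import Data.Product using (Σ; ∃; _×_; _,_)
open import Data.Sum using (_⊎_)
open import Relation.Nullary using (¬_)
open import Relation.Binary using (Decidable)
open import Relation.Binary.PropositionalEquality using (_≡_; _≢_)
open import Relation.Binary.Construct.Closure.ReflexiveTransitive using (Star)
open import Function using (Injective)

record Graph (n : ℕ) : Set₁ where
  field
    Adj    : Fin n → Fin n → Set
    adj?   : Decidable Adj
    sym    : ∀ {x y} → Adj x y → Adj y x
    irrefl : ∀ {x} → ¬ Adj x x
open Graph public

-- An edge set is represented by a (symmetric) relation on vertices;
-- F x y means the edge xy belongs to F.
EdgeSet : ℕ → Set₁
EdgeSet n = Fin n → Fin n → Set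

SameEdge : ∀ {n} → Fin n → Fin n → Fin n → Fin n → Set
SameEdge x y a b = (x ≡ a × y ≡ b) ⊎ (x ≡ b × y ≡ a)

IsEdgeSetOf : ∀ {n} → Graph n → EdgeSet n → Set
IsEdgeSetOf {n} G F = (∀ x y → F x y → F y x) × (∀ x y → F x y → Adj G x y)

-- A total ordering of the edges of G, given by an injective ranking
-- (edge xy is smaller than edge ab iff rank x y < rank a b).
record EdgeOrder {n} (G : Graph n) : Set where
  field
    rank     : Fin n → Fin n → ℕ
    rank-sym : ∀ x y → rank x y ≡ rank y x
    rank-inj : ∀ {x y a b} → Adj G x y → Adj G a b →
               rank x y ≡ rank a b → SameEdge x y a b
open EdgeOrder public

data DirEdge {n k : ℕ} (c : Fin (suc k) → Fin n) : Fin n → Fin n → Set where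
  step  : (j : Fin k) → DirEdge c (c (inject₁ j)) (c (suc j))
  close : DirEdge c (c (fromℕ k)) (c zero)

CycleEdge : ∀ {n k} → (Fin (suc k) → Fin n) → Fin n → Fin n → Set
CycleEdge c x y = DirEdge c x y ⊎ DirEdge c y x

record Cycle {n} (Adj' : Fin n → Fin n → Set) : Set where
  field
    m     : ℕ
    verts : Fin (suc (suc (suc m))) → Fin n
    inj   : Injective _≡_ _≡_ verts
    edges : ∀ x y → CycleEdge verts x y → Adj' x y
open Cycle public

IsLargestEdge : ∀ {n} {A : Fin n → Fin n → Set} →
  (Fin n → Fin n → ℕ) → Cycle A → Fin n → Fin n → Set
IsLargestEdge r C a b =
  CycleEdge (verts C) a b × (∀ x y → CycleEdge (verts C) x y → r x y ≤ r a b)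

ContainsBrokenCircuit : ∀ {n} (G : Graph n) → EdgeOrder G → EdgeSet n → Set
ContainsBrokenCircuit {n} G o T =
  Σ (Cycle (Adj G)) λ C → Σ (Fin n × Fin n) λ where
    (a , b) → IsLargestEdge (rank o) C a b ×
              (∀ x y → CycleEdge (verts C) x y → ¬ SameEdge x y a b → T x y)

BrokenCircuitFree : ∀ {n} (G : Graph n) → EdgeOrder G → EdgeSet n → Set
BrokenCircuitFree G o F = ¬ ContainsBrokenCircuit G o F

Acyclic : ∀ {n} → EdgeSet n → Set
Acyclic T = ¬ Cycle T

Incident : ∀ {n} → EdgeSet n → Fin n → Set
Incident T x = ∃ λ y → T x y

IsTree : ∀ {n} → EdgeSet n → Set
IsTree {n} T = Acyclic T × (∀ x y → Incident T x → Incident T y → Star T x y)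

-- The induced subgraph G[V ∖ {u}], kept on vertex set Fin n with u made
-- isolated (u then lies in no cycle and no edge, so cycles, edge sets and
-- non-trivial components coincide with those of G[V ∖ {u}]).
deleteVertex : ∀ {n} → Graph n → Fin n → Graph n
deleteVertex {n} G u = record
  { Adj = λ x y → Adj G x y × x ≢ u × y ≢ u
  ; adj? = dec
  ; sym = λ (e , p , q) → sym G e , q , p
  ; irrefl = λ (e , _) → irrefl G e
  }
  where
  open import Relation.Nullary using (Dec; yes; no)
  open import Relation.Nullary.Decidable using (_×-dec_; ¬?)
  open import Data.Fin using (_≟_)
  dec : Decidable (λ x y → Adj G x y × x ≢ u × y ≢ u)
  dec x y = adj? G x y ×-dec (¬? (x ≟ u) ×-dec ¬? (y ≟ u))

deleteVertexOrder : ∀ {n} (G : Graph n) (u : Fin n) → EdgeOrder G →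
                    EdgeOrder (deleteVertex G u)
deleteVertexOrder G u o = record
  { rank = rank o
  ; rank-sym = rank-sym o
  ; rank-inj = λ e f eq → rank-inj o (Data.Product.proj₁ e) (Data.Product.proj₁ f) eq
  }
  where import Data.Product

addStar : ∀ {n} → EdgeSet n → Fin n → (Fin n → Set) → EdgeSet n
addStar F u S x y = F x y ⊎ (x ≡ u × S y) ⊎ (S x × y ≡ u)

{-# OPTIONS --safe #-}
module Submission where

-- Since the edges at u are the largest, a cycle C of G whose edges other than its largest one
-- all lie in T must pass through u (otherwise it is a broken circuit of F), and its largest
-- edge is then some ut; the rest of C is an F-path from t to the other neighbour s of u on C,
-- with us ∈ T and us < ut. For a cycle of T also t ∈ S, contradicting the uniqueness of the
-- S-vertex in the component of s; so T is acyclic, and it is connected because every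
-- F-component hangs from u by its star edge. Conversely, given such s and t, a simple F-path
-- from s to t closes up through u to a cycle whose largest edge is ut.

open import Defs
open import Data.Nat using (ℕ; zero; suc; _≤_; _<_)
open import Data.Nat.Properties using (≤-refl; ≤-trans; ≤-total; <⇒≤; <⇒≱; ≤∧≢⇒<; <-irrefl; ≤-reflexive)
open import Data.Fin using (Fin; zero; suc; inject₁; fromℕ; _≟_)
open import Data.Fin.Properties using (fromℕ≢inject₁; inject₁-injective; suc-injective; any?)
open import Data.Fin.Induction using (>-weakInduction)
open import Data.Fin.Relation.Unary.Top using (view; ‵fromℕ; ‵inject₁)
open import Data.Vec.Functional using (_∷_)
open import Data.Product using (Σ-syntax; ∃; _×_; _,_; proj₁; proj₂) renaming (swap to ×-swap)
open import Data.Sum using (_⊎_; inj₁; inj₂; swap) renaming (map to ⊎-map)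
open import Data.Empty using (⊥-elim)
open import Function using (Injective; _∘_)
open import Function.Bundles using (_⇔_; mk⇔)
open import Relation.Nullary using (¬_; yes; no)
open import Relation.Binary using (_⇒_)
open import Relation.Binary.PropositionalEquality using (_≡_; _≢_; refl; trans; cong; subst) renaming (sym to ≡-sym)
open import Relation.Binary.Construct.Closure.ReflexiveTransitive using (Star; ε; _◅_; _◅◅_; reverse) renaming (map to Star-map)

private variable
  n k : ℕ

module _ {c : Fin (suc k) → Fin n} where

  CycleEdge-sym : ∀ {x y} → CycleEdge c x y → CycleEdge c y x
  CycleEdge-sym = swap

  cycleEdge-elim : {P : Fin n → Fin n → Set} → (∀ {x y} → P x y → P y x) →
                   DirEdge c ⇒ P → CycleEdge c ⇒ P
  cycleEdge-elim P-sym dir (inj₁ d) = dir d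
  cycleEdge-elim P-sym dir (inj₂ d) = P-sym (dir d)

SameEdge-swap : {x y a b : Fin n} → SameEdge x y a b → SameEdge y x a b
SameEdge-swap (inj₁ (x≡a , y≡b)) = inj₂ (y≡b , x≡a)
SameEdge-swap (inj₂ (x≡b , y≡a)) = inj₁ (y≡a , x≡b)

SameEdge-flip : {x y a b : Fin n} → SameEdge x y a b → SameEdge x y b a
SameEdge-flip = swap

SameEdge-endpoint : {x y y′ : Fin n} → x ≢ y → SameEdge x y′ x y → y′ ≡ y
SameEdge-endpoint x≢y (inj₁ (_ , y′≡y)) = y′≡y
SameEdge-endpoint x≢y (inj₂ (x≡y , _))  = ⊥-elim (x≢y x≡y)

cycleEdge-avoids : {c : Fin (suc k) → Fin n} {w : Fin n} → (∀ i → c i ≢ w) →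
                   ∀ {x y} → CycleEdge c x y → x ≢ w × y ≢ w
cycleEdge-avoids {c = c} {w} avoids = cycleEdge-elim ×-swap avoids-dir
  where
  avoids-dir : DirEdge c ⇒ λ x y → x ≢ w × y ≢ w
  avoids-dir (step j) = avoids _ , avoids _
  avoids-dir close    = avoids _ , avoids _

-- rotate c i is the cyclic predecessor of c i: the same cycle, read from its last vertex.
rotate : (Fin (suc k) → Fin n) → Fin (suc k) → Fin n
rotate {k} c zero    = c (fromℕ k)
rotate     c (suc j) = c (inject₁ j)

rotate-injective : {c : Fin (suc k) → Fin n} →
                   Injective _≡_ _≡_ c → Injective _≡_ _≡_ (rotate c)
rotate-injective c-inj {zero}  {zero}  _ = refl
rotate-injective c-inj {zero}  {suc j} e = ⊥-elim (fromℕ≢inject₁ (c-inj e))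
rotate-injective c-inj {suc i} {zero}  e = ⊥-elim (fromℕ≢inject₁ (≡-sym (c-inj e)))
rotate-injective c-inj {suc i} {suc j} e = cong suc (inject₁-injective (c-inj e))

rotate-dirEdge : {c : Fin (suc k) → Fin n} → DirEdge (rotate c) ⇒ DirEdge c
rotate-dirEdge {k = zero}  close = close
rotate-dirEdge {k = suc k} close = step (fromℕ k)
rotate-dirEdge (step zero)       = close
rotate-dirEdge (step (suc j))    = step (inject₁ j)

dirEdge-rotate : {c : Fin (suc k) → Fin n} → DirEdge c ⇒ DirEdge (rotate c)
dirEdge-rotate {k = zero}  close = close
dirEdge-rotate {k = suc k} close = step zero
dirEdge-rotate (step j) with view j
... | ‵fromℕ     = close
... | ‵inject₁ i = step (suc i)

dirEdge-into : {c : Fin (suc k) → Fin n} → ∀ i → DirEdge c (rotate c i) (c i)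
dirEdge-into zero    = close
dirEdge-into (suc j) = step j

dirEdge-index : {c : Fin (suc k) → Fin n} →
                ∀ {x y} → DirEdge c x y → ∃ λ i → x ≡ rotate c i × y ≡ c i
dirEdge-index (step j) = suc j , refl , refl
dirEdge-index close    = zero , refl , refl

Rotation : (Fin (suc k) → Fin n) → Fin n → Set
Rotation {k} {n} c w = Σ[ c′ ∈ (Fin (suc k) → Fin n) ]
  Injective _≡_ _≡_ c′ × c′ zero ≡ w ×
  (CycleEdge c ⇒ CycleEdge c′) × (CycleEdge c′ ⇒ CycleEdge c)

rotation-rotate : {c : Fin (suc k) → Fin n} {w : Fin n} → Rotation (rotate c) w → Rotation c w
rotation-rotate (c′ , c′-inj , starts , to , from) =
  c′ , c′-inj , starts ,
  to ∘ ⊎-map dirEdge-rotate dirEdge-rotate , ⊎-map rotate-dirEdge rotate-dirEdge ∘ from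

rotation : (c : Fin (suc k) → Fin n) → Injective _≡_ _≡_ c → ∀ i → Rotation c (c i)
rotation {k} {n} c c-inj i = >-weakInduction P once later i c c-inj
  where
  P : Fin (suc k) → Set
  P i = ∀ c → Injective _≡_ _≡_ c → Rotation c (c i)

  once : P (fromℕ k)
  once c c-inj = rotation-rotate (rotate c , rotate-injective c-inj , refl , (λ e → e) , (λ e → e))

  -- c (inject₁ j) is vertex suc j of rotate c.
  later : ∀ j → P (suc j) → P (inject₁ j)
  later j P-suc c c-inj = rotation-rotate (P-suc (rotate c) (rotate-injective c-inj))

module _ {A : Fin n → Fin n → Set} where

  rotateCycle : (C : Cycle A) → ∀ i →
    Σ[ D ∈ Cycle A ] verts D zero ≡ verts C i ×
      (CycleEdge (verts C) ⇒ CycleEdge (verts D)) × (CycleEdge (verts D) ⇒ CycleEdge (verts C))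
  rotateCycle C i with rotation (verts C) (inj C) i
  ... | c′ , c′-inj , starts , to , from =
    record { m = m C ; verts = c′ ; inj = c′-inj ; edges = λ x y → edges C x y ∘ from } ,
    starts , to , from

  IsLargestEdge-flip : ∀ {r : Fin n → Fin n → ℕ} → (∀ x y → r x y ≡ r y x) →
    ∀ {C : Cycle A} {a b} → IsLargestEdge r C a b → IsLargestEdge r C b a
  IsLargestEdge-flip r-sym {a = a} {b} (ab , max) =
    CycleEdge-sym ab , λ x y e → ≤-trans (max x y e) (≤-reflexive (r-sym a b))

Cycle-map : {A B : Fin n → Fin n → Set} → A ⇒ B → Cycle A → Cycle B
Cycle-map A⇒B C =
  record { m = m C ; verts = verts C ; inj = inj C ; edges = λ x y → A⇒B ∘ edges C x y }

argmax : (f : Fin (suc k) → ℕ) → ∃ λ i → ∀ j → f j ≤ f i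
argmax {zero} f = zero , λ { zero → ≤-refl }
argmax {suc k} f with argmax (f ∘ suc)
... | i , max with ≤-total (f zero) (f (suc i))
...   | inj₁ f0≤ = suc i , λ { zero → f0≤ ; (suc j) → max j }
...   | inj₂ ≤f0 = zero , λ { zero → ≤-refl ; (suc j) → ≤-trans (max j) ≤f0 }

largestEdge : {A : Fin n → Fin n → Set} (r : Fin n → Fin n → ℕ) → (∀ x y → r x y ≡ r y x) →
  (C : Cycle A) → ∃ λ a → ∃ λ b → IsLargestEdge r C a b
largestEdge r r-sym C with argmax (λ i → r (rotate (verts C) i) (verts C i))
... | i , max = rotate (verts C) i , verts C i , inj₁ (dirEdge-into i) , bound
  where
  bound : ∀ x y → CycleEdge (verts C) x y → r x y ≤ r (rotate (verts C) i) (verts C i)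
  bound x y (inj₁ d) with dirEdge-index d
  ... | j , refl , refl = max j
  bound x y (inj₂ d) with dirEdge-index d
  ... | j , refl , refl = ≤-trans (≤-reflexive (r-sym x y)) (max j)

cycleEdge-from-start : {c : Fin (suc (suc k)) → Fin n} → Injective _≡_ _≡_ c →
  ∀ {x y} → CycleEdge c x y → x ≡ c zero → y ≡ c (suc zero) ⊎ y ≡ c (fromℕ (suc k))
cycleEdge-from-start c-inj (inj₁ (step zero))    _ = inj₁ refl
cycleEdge-from-start c-inj (inj₁ (step (suc j))) e with () ← c-inj e
cycleEdge-from-start c-inj (inj₁ close)          e with () ← c-inj e
cycleEdge-from-start c-inj (inj₂ (step j))       e with () ← c-inj e
cycleEdge-from-start c-inj (inj₂ close)          _ = inj₂ refl

Links : (Fin n → Fin n → Set) → (Fin (suc k) → Fin n) → Set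
Links {k = k} R p = (j : Fin k) → R (p (inject₁ j)) (p (suc j))

links-walk : {R : Fin n → Fin n → Set} (p : Fin (suc k) → Fin n) →
             Links R p → Star R (p zero) (p (fromℕ k))
links-walk {k = zero}  p links = ε
links-walk {k = suc k} p links = links zero ◅ links-walk (p ∘ suc) (links ∘ suc)

∷-injective : {x : Fin n} {p : Fin k → Fin n} → (∀ i → p i ≢ x) →
              Injective _≡_ _≡_ p → Injective _≡_ _≡_ (x ∷ p)
∷-injective x∉p p-inj {zero}  {zero}  _ = refl
∷-injective x∉p p-inj {zero}  {suc j} e = ⊥-elim (x∉p j (≡-sym e))
∷-injective x∉p p-inj {suc i} {zero}  e = ⊥-elim (x∉p i e)
∷-injective x∉p p-inj {suc i} {suc j} e = cong suc (p-inj e)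

record SimplePath (R : Fin n → Fin n → Set) (s t : Fin n) : Set where
  constructor mkPath
  field
    len       : ℕ
    vertex    : Fin (suc len) → Fin n
    starts    : vertex zero ≡ s
    ends      : vertex (fromℕ len) ≡ t
    injective : Injective _≡_ _≡_ vertex
    linked    : Links R vertex

module _ {R : Fin n → Fin n → Set} where
  open SimplePath

  suffix : ∀ {s t} (P : SimplePath R s t) (i : Fin (suc (len P))) → SimplePath R (vertex P i) t
  suffix (mkPath k p _ ends p-inj links) zero = mkPath k p refl ends p-inj links
  suffix (mkPath (suc k) p _ ends p-inj links) (suc i) =
    suffix (mkPath k (p ∘ suc) refl ends (λ e → suc-injective (p-inj e)) (links ∘ suc)) i

  prepend : ∀ {s x t} → R s x → (P : SimplePath R x t) → (∀ i → vertex P i ≢ s) →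
            SimplePath R s t
  prepend {s} e (mkPath k p refl ends p-inj links) s∉P =
    mkPath (suc k) (s ∷ p) refl ends (∷-injective s∉P p-inj) links′
    where
    links′ : Links R (s ∷ p)
    links′ zero    = e
    links′ (suc j) = links j

  shortcut : ∀ {s t} → Star R s t → SimplePath R s t
  shortcut {t = t} ε = mkPath 0 (λ _ → t) refl refl (λ { {zero} {zero} _ → refl }) (λ ())
  shortcut {s = s} (e ◅ w) with shortcut w
  ... | P with any? (λ i → vertex P i ≟ s)
  ...   | yes (i , refl) = suffix P i
  ...   | no s∉P         = prepend e P (λ i eq → s∉P (i , eq))

module StarExtension
  {n} (G : Graph n) (o : EdgeOrder G) (u : Fin n) (S : Fin n → Set)
  (S⊆N[u] : ∀ s → S s → Adj G u s)
  (u-edges-largest : ∀ x a b → Adj G u x → Adj G a b → a ≢ u → b ≢ u → rank o a b < rank o u x)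
  (F : EdgeSet n)
  (F-edges : IsEdgeSetOf (deleteVertex G u) F)
  (F-bcf : BrokenCircuitFree (deleteVertex G u) (deleteVertexOrder G u o) F)
  (reaches-S : ∀ x → Incident F x → ∃ λ s → S s × Star F x s)
  (unique-S : ∀ x s s′ → Incident F x → S s → S s′ → Star F x s → Star F x s′ → s ≡ s′)
  where

  T : EdgeSet n
  T = addStar F u S

  F-sym : ∀ {x y} → F x y → F y x
  F-sym = proj₁ F-edges _ _

  F-avoids-u : ∀ {x y} → F x y → Adj G x y × x ≢ u × y ≢ u
  F-avoids-u = proj₂ F-edges _ _

  walk-incident : ∀ {s t} → s ≢ t → Star F s t → Incident F s
  walk-incident s≢t ε       = ⊥-elim (s≢t refl)
  walk-incident s≢t (f ◅ _) = _ , f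

  S-≢u : ∀ {s} → S s → s ≢ u
  S-≢u Ss refl = irrefl G (S⊆N[u] _ Ss)

  T-sym : ∀ {x y} → T x y → T y x
  T-sym (inj₁ f)                    = inj₁ (F-sym f)
  T-sym (inj₂ (inj₁ (x≡u , Sy)))    = inj₂ (inj₂ (Sy , x≡u))
  T-sym (inj₂ (inj₂ (Sx , y≡u)))    = inj₂ (inj₁ (y≡u , Sx))

  T⊆E : ∀ {x y} → T x y → Adj G x y
  T⊆E (inj₁ f)                      = proj₁ (F-avoids-u f)
  T⊆E (inj₂ (inj₁ (refl , Sy)))     = S⊆N[u] _ Sy
  T⊆E (inj₂ (inj₂ (Sx , refl)))     = Graph.sym G (S⊆N[u] _ Sx)

  T-away-from-u : ∀ {x y} → T x y → x ≢ u → y ≢ u → F x y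
  T-away-from-u (inj₁ f)                   _   _   = f
  T-away-from-u (inj₂ (inj₁ (x≡u , _)))    x≢u _   = ⊥-elim (x≢u x≡u)
  T-away-from-u (inj₂ (inj₂ (_ , y≡u)))    _   y≢u = ⊥-elim (y≢u y≡u)

  T-at-u : ∀ {x y} → T x y → x ≡ u → S y
  T-at-u (inj₁ f)                   x≡u  = ⊥-elim (proj₁ (proj₂ (F-avoids-u f)) x≡u)
  T-at-u (inj₂ (inj₁ (_ , Sy)))     _    = Sy
  T-at-u (inj₂ (inj₂ (Sx , refl)))  refl = ⊥-elim (S-≢u Sx refl)

  reaches-u : ∀ {x} → Incident T x → Star T x u
  reaches-u {x} (y , inj₁ f) with reaches-S x (y , f)
  ... | s , Ss , x→s = Star-map inj₁ x→s ◅◅ (inj₂ (inj₂ (Ss , refl)) ◅ ε)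
  reaches-u (_ , inj₂ (inj₁ (refl , _)))  = ε
  reaches-u (_ , inj₂ (inj₂ (Sx , refl))) = inj₂ (inj₂ (Sx , refl)) ◅ ε

  connected : ∀ x y → Incident T x → Incident T y → Star T x y
  connected x y Tx Ty = reaches-u Tx ◅◅ reverse T-sym (reaches-u Ty)

  OutranksStarEdge : Fin n → Set
  OutranksStarEdge t = ∃ λ s → S s × s ≢ t × Star F s t × rank o u s < rank o u t

  OtherEdgesInT : Cycle (Adj G) → Fin n → Fin n → Set
  OtherEdgesInT C a b = ∀ x y → CycleEdge (verts C) x y → ¬ SameEdge x y a b → T x y

  broken-circuit-meets-u : (C : Cycle (Adj G)) → ∀ {a b} → IsLargestEdge (rank o) C a b →
    OtherEdgesInT C a b → ∃ λ i → verts C i ≡ u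
  broken-circuit-meets-u C {a} {b} largest others with any? (λ i → verts C i ≟ u)
  ... | yes meets = meets
  ... | no avoids = ⊥-elim (F-bcf (C′ , (a , b) , largest , in-F))
    where
    avoids-u : ∀ {x y} → CycleEdge (verts C) x y → x ≢ u × y ≢ u
    avoids-u = cycleEdge-avoids (λ i ci≡u → avoids (i , ci≡u))
    C′ : Cycle (Adj (deleteVertex G u))
    C′ = record { m = m C ; verts = verts C ; inj = inj C
                ; edges = λ x y e → edges C x y e , avoids-u e }
    in-F : ∀ x y → CycleEdge (verts C) x y → ¬ SameEdge x y a b → F x y
    in-F x y e ne = let (x≢u , y≢u) = avoids-u e in T-away-from-u (others x y e ne) x≢u y≢u

  largest-edge-at-u : (C : Cycle (Adj G)) → ∀ {x a b} → CycleEdge (verts C) u x →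
    IsLargestEdge (rank o) C a b → a ≡ u ⊎ b ≡ u
  largest-edge-at-u C {x} {a} {b} ux (ab , max) with a ≟ u | b ≟ u
  ... | yes a≡u | _       = inj₁ a≡u
  ... | no _    | yes b≡u = inj₂ b≡u
  ... | no a≢u  | no b≢u  =
    ⊥-elim (<⇒≱ (u-edges-largest x a b (edges C u x ux) (edges C a b ab) a≢u b≢u) (max u x ux))

  module _ (D : Cycle (Adj G)) (d₀≡u : verts D zero ≡ u) {r : Fin n}
           (largest : IsLargestEdge (rank o) D u r) (others : OtherEdgesInT D u r) where

    private
      ur  = proj₁ largest
      max = proj₂ largest
      c = verts D
      first = c (suc zero)
      last  = c (fromℕ (suc (suc (m D))))

      from-u : ∀ {y} → CycleEdge c (c zero) y → CycleEdge c u y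
      from-u = subst (λ z → CycleEdge c z _) d₀≡u

      first≢last : first ≢ last
      first≢last e with () ← suc-injective (inj D e)

      inner≢u : ∀ i → c (suc i) ≢ u
      inner≢u i e with () ← inj D (trans e (≡-sym d₀≡u))

      in-F : ∀ {x y} → CycleEdge c x y → x ≢ u → y ≢ u → F x y
      in-F {x} {y} e x≢u y≢u = T-away-from-u (others x y e not-ur) x≢u y≢u
        where
        not-ur : ¬ SameEdge x y u r
        not-ur (inj₁ (x≡u , _)) = x≢u x≡u
        not-ur (inj₂ (_ , y≡u)) = y≢u y≡u

      inner-walk : Star F first last
      inner-walk = links-walk (c ∘ suc) (λ j → in-F (inj₁ (step (suc j))) (inner≢u _) (inner≢u _))

      u≢r : u ≢ r
      u≢r u≡r = irrefl G (subst (Adj G u) (≡-sym u≡r) (edges D u r ur))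

      outranked : ∀ {r′} → r′ ≢ r → CycleEdge c u r′ → Star F r′ r → OutranksStarEdge r
      outranked {r′} r′≢r ur′ r′→r =
        r′ , T-at-u (others u r′ ur′ (r′≢r ∘ SameEdge-endpoint u≢r)) refl , r′≢r , r′→r ,
        ≤∧≢⇒< (max u r′ ur′)
              (r′≢r ∘ SameEdge-endpoint u≢r ∘ rank-inj o (edges D u r′ ur′) (edges D u r ur))

    -- Removing u from D leaves the path first, …, last between its two neighbours; r is one
    -- end of it and the other end is the witness.
    largest-start-edge-outranks : OutranksStarEdge r
    largest-start-edge-outranks with cycleEdge-from-start (inj D) ur (≡-sym d₀≡u)
    ... | inj₁ r≡first =
      outranked (λ e → first≢last (≡-sym (trans e r≡first))) (from-u (inj₂ close))
                (subst (Star F last) (≡-sym r≡first) (reverse F-sym inner-walk))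
    ... | inj₂ r≡last =
      outranked (λ e → first≢last (trans e r≡last)) (from-u (inj₁ (step zero)))
                (subst (Star F first) (≡-sym r≡last) inner-walk)

  broken-circuit-starting-at-u : (D : Cycle (Adj G)) → verts D zero ≡ u → ∀ {a b} →
    IsLargestEdge (rank o) D a b → OtherEdgesInT D a b →
    ∃ λ t → CycleEdge (verts D) u t × OutranksStarEdge t
  broken-circuit-starting-at-u D d₀≡u {a} {b} largest@(ab , _) others
    with largest-edge-at-u D (subst (λ z → CycleEdge (verts D) z (verts D (suc zero))) d₀≡u
                                    (inj₁ (step zero))) largest
  ... | inj₁ refl = b , ab , largest-start-edge-outranks D d₀≡u largest others
  ... | inj₂ refl = a , CycleEdge-sym ab ,
    largest-start-edge-outranks D d₀≡u (IsLargestEdge-flip (rank-sym o) {C = D} largest)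
      (λ x y e ne → others x y e (ne ∘ SameEdge-flip))

  broken-circuit-outranks : (C : Cycle (Adj G)) → ∀ {a b} → IsLargestEdge (rank o) C a b →
    OtherEdgesInT C a b → ∃ λ t → CycleEdge (verts C) u t × OutranksStarEdge t
  broken-circuit-outranks C (ab , max) others with broken-circuit-meets-u C (ab , max) others
  ... | i , cᵢ≡u with rotateCycle C i
  ...   | D , d₀≡cᵢ , to , from with broken-circuit-starting-at-u D (trans d₀≡cᵢ cᵢ≡u)
                                       (to ab , λ x y → max x y ∘ from) (λ x y → others x y ∘ from)
  ...     | t , ut , outranks = t , from ut , outranks

  acyclic : Acyclic T
  acyclic C with largestEdge (rank o) (rank-sym o) (Cycle-map T⊆E C)
  ... | a , b , largest with broken-circuit-outranks (Cycle-map T⊆E C) largest (λ x y e _ → edges C x y e)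
  ... | t , ut , s , Ss , s≢t , s→t , _ =
    s≢t (unique-S s s t (walk-incident s≢t s→t) Ss (T-at-u (edges C u t ut) refl) ε s→t)

  Condition : Set
  Condition = ∃ λ s → S s × Incident F s ×
                (∃ λ t → Adj G u t × Star F s t × rank o u s < rank o u t)

  broken-circuit⇒condition : ContainsBrokenCircuit G o T → Condition
  broken-circuit⇒condition (C , _ , largest , others) with broken-circuit-outranks C largest others
  ... | t , ut , s , Ss , s≢t , s→t , us<ut =
    s , Ss , walk-incident s≢t s→t , t , edges C u t ut , s→t , us<ut

  cone-broken-circuit : ∀ {s t} → S s → Adj G u t → rank o u s < rank o u t →
    SimplePath F s t → ContainsBrokenCircuit G o T
  cone-broken-circuit Ss ut us<ut (mkPath zero _ refl refl _ _) = ⊥-elim (<-irrefl refl us<ut)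
  cone-broken-circuit {s} {t} Ss ut us<ut (mkPath (suc ℓ) p refl refl p-inj links) =
    cone , (u , t) , (inj₂ close , λ x y → cycleEdge-elim rank-flip bounded) ,
    λ x y → cycleEdge-elim other-flip others
    where
    p≢u : ∀ i → p i ≢ u
    p≢u zero    = S-≢u Ss
    p≢u (suc j) = proj₂ (proj₂ (F-avoids-u (links j)))

    adjacent : DirEdge (u ∷ p) ⇒ Adj G
    adjacent (step zero)    = S⊆N[u] _ Ss
    adjacent (step (suc j)) = proj₁ (F-avoids-u (links j))
    adjacent close          = Graph.sym G ut

    cone : Cycle (Adj G)
    cone = record { m = ℓ ; verts = u ∷ p ; inj = ∷-injective p≢u p-inj
                  ; edges = λ x y → cycleEdge-elim (Graph.sym G) adjacent }

    rank-flip : ∀ {x y} → rank o x y ≤ rank o u t → rank o y x ≤ rank o u t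
    rank-flip {x} {y} = ≤-trans (≤-reflexive (rank-sym o y x))

    bounded : DirEdge (u ∷ p) ⇒ λ x y → rank o x y ≤ rank o u t
    bounded (step zero)    = <⇒≤ us<ut
    bounded (step (suc j)) = let (a , a≢u , b≢u) = F-avoids-u (links j) in
                             <⇒≤ (u-edges-largest t _ _ ut a a≢u b≢u)
    bounded close          = ≤-reflexive (rank-sym o t u)

    other-flip : ∀ {x y} → (¬ SameEdge x y u t → T x y) → ¬ SameEdge y x u t → T y x
    other-flip in-T ne = T-sym (in-T (ne ∘ SameEdge-swap))

    others : DirEdge (u ∷ p) ⇒ λ x y → ¬ SameEdge x y u t → T x y
    others (step zero)    _  = inj₂ (inj₁ (refl , Ss))
    others (step (suc j)) _  = inj₁ (links j)
    others close          ne = ⊥-elim (ne (inj₂ (refl , refl)))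

  condition⇒broken-circuit : Condition → ContainsBrokenCircuit G o T
  condition⇒broken-circuit (s , Ss , _ , t , ut , s→t , us<ut) =
    cone-broken-circuit Ss ut us<ut (shortcut s→t)

proposition2p4 : ∀ {n} (G : Graph n) (o : EdgeOrder G) (u : Fin n) (S : Fin n → Set)
    → (∀ s → S s → Adj G u s)
    → (∀ x a b → Adj G u x → Adj G a b → a ≢ u → b ≢ u → rank o a b < rank o u x)
    → (F : EdgeSet n)
    → IsEdgeSetOf (deleteVertex G u) F
    → BrokenCircuitFree (deleteVertex G u) (deleteVertexOrder G u o) F
    → (∀ x → Incident F x → ∃ λ s → S s × Star F x s)
    → (∀ x s s′ → Incident F x → S s → S s′ → Star F x s → Star F x s′ → s ≡ s′)
    → IsTree (addStar F u S)
      × (ContainsBrokenCircuit G o (addStar F u S)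
         ⇔ (∃ λ s → S s × Incident F s ×
              (∃ λ t → Adj G u t × Star F s t × rank o u s < rank o u t)))
proposition2p4 G o u S S⊆N[u] u-edges-largest F F-edges F-bcf reaches-S unique-S =
  (acyclic , connected) , mk⇔ broken-circuit⇒condition condition⇒broken-circuit
  where open StarExtension G o u S S⊆N[u] u-edges-largest F F-edges F-bcf reaches-S unique-S
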